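{- Let $M$ be a fixed positive integer, and suppose that $\beta>0$ is such that $c_k(n)\leq\beta^n$ for every integer $k\geq 0$ divisible by $M$ and every integer $n\geq k$. Then $c(n)\leq\beta^n$ for all positive integers $n$.
   Context: A pair $(\mathcal{A},\mathcal{B})$ of families of subsets of a finite set $S$ is called cancellative if (i) whenever $A,A'\in\mathcal{A}$ and $B\in\mathcal{B}$ satisfy $A\cup B=A'\cup B$, then $A=A'$; and (ii) whenever $A\in\mathcal{A}$ and $B,B'\in\mathcal{B}$ satisfy $A\cup B=A\cup B'$, then $B=B'$. Such a pair is called $k$-uniform if $|A|=|B|=k$ for all $A\in\mathcal{A}$, $B\in\mathcal{B}$. Let $c(n)$ denote the maximum of $|\mathcal{A}||\mathcal{B}|$ over all cancellative pairs over an $n$-element set, and $c_k(n)$ the maximum of $|\mathcal{A}||\mathcal{B}|$ over all $k$-uniform cancellative pairs over an $n$-element set. -}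

module Defs where

open import Data.Nat using (ℕ; zero; suc)
import Data.Nat as ℕ
open import Data.Integer using (+_)
open import Data.Rational using (ℚ; _≤_; _<_; _*_; 1ℚ; _/_)
open import Data.Fin.Subset using (Subset; _∪_; ∣_∣)
open import Data.List using (List; length)
open import Data.List.Membership.Propositional using (_∈_)
open import Data.List.Relation.Unary.Unique.Propositional using (Unique)
open import Data.Product using (Σ; ∃; _×_)
open import Relation.Binary.PropositionalEquality using (_≡_)
open import Relation.Nullary using (¬_)

_^ℚ_ : ℚ → ℕ → ℚ
q ^ℚ zero  = 1ℚ
q ^ℚ suc n = q * (q ^ℚ n)

ℕ→ℚ : ℕ → ℚ
ℕ→ℚ m = + m / 1

-- A positive real number β, represented by its (open) Dedekind upper cut
-- U = { q ∈ ℚ | β < q }.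
record PosReal : Set₁ where
  field
    U         : ℚ → Set
    inhabited : ∃ λ q → U q
    upward    : ∀ {p q} → U p → p ≤ q → U q
    rounded   : ∀ {q} → U q → ∃ λ p → U p × p < q
    positive  : ∃ λ q → (ℕ→ℚ 0 < q) × ¬ U q

-- "m ≤ β ^ n" for a natural m: m ≤ q ^ n for every rational q > β.
_≤β^_ : ℕ → PosReal → ℕ → Set
(m ≤β^ β) n = ∀ q → PosReal.U β q → ℕ→ℚ m ≤ q ^ℚ n

Family : ℕ → Set
Family n = List (Subset n)

Cancellative : ∀ {n} → Family n → Family n → Set
Cancellative 𝒜 ℬ =
  (∀ {A A′ B} → A ∈ 𝒜 → A′ ∈ 𝒜 → B ∈ ℬ → A ∪ B ≡ A′ ∪ B → A ≡ A′) ×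
  (∀ {A B B′} → A ∈ 𝒜 → B ∈ ℬ → B′ ∈ ℬ → A ∪ B ≡ A ∪ B′ → B ≡ B′)

Uniform : ∀ {n} → ℕ → Family n → Set
Uniform k 𝒜 = ∀ {A} → A ∈ 𝒜 → ∣ A ∣ ≡ k

-- "c(n) ≤ β^n": every cancellative pair over an n-set has |𝒜||ℬ| ≤ β^n
c≤β^ : PosReal → ℕ → Set
c≤β^ β n = (𝒜 ℬ : Family n) → Unique 𝒜 → Unique ℬ → Cancellative 𝒜 ℬ →
           ((length 𝒜 ℕ.* length ℬ) ≤β^ β) n

-- "c_k(n) ≤ β^n": same, over k-uniform cancellative pairs
ck≤β^ : PosReal → ℕ → ℕ → Set
ck≤β^ β k n = (𝒜 ℬ : Family n) → Unique 𝒜 → Unique ℬ → Cancellative 𝒜 ℬ →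
              Uniform k 𝒜 → Uniform k ℬ →
              ((length 𝒜 ℕ.* length ℬ) ≤β^ β) n

-- Tensor powers multiply sizes: if (𝒜, ℬ) is cancellative on n points, so is
-- (𝒜ᵗ, ℬᵗ) on tn points, with |𝒜ᵗ||ℬᵗ| = (|𝒜||ℬ|)ᵗ, and k-uniform pairs become
-- tk-uniform.  Taking M-th powers therefore extends the hypothesis from M ∣ k
-- to all k.  For an arbitrary pair, the most popular layers 𝒜ᵗ_a and ℬᵗ_b of
-- the t-th powers keep a fraction 1/(tn+1) each, and (𝒜ᵗ_a ⊗ ℬᵗ_b, ℬᵗ_b ⊗ 𝒜ᵗ_a)
-- is an (a+b)-uniform pair on 2tn points, whence (|𝒜||ℬ|)ᵗ ≤ (tn+1)² βᵗⁿ for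
-- every t.  A polynomial factor cannot beat exponential growth, so |𝒜||ℬ| ≤ βⁿ.
-- As β is only given by its upper cut, every inequality is checked against a
-- rational q = a/b > β, where it becomes an inequality between naturals.

module Submission where

open import Defs
open import Data.Bool using (true; false)
open import Data.Empty using (⊥-elim)
open import Data.Fin.Subset using (Subset; _∪_; ∣_∣)
open import Data.Fin.Subset.Properties using (∣p∣≤n; ∪-comm)
open import Data.Integer as ℤ using (-[1+_])
import Data.Integer.Properties as ℤₚ
open import Data.List as List using (List; []; _∷_; [_]; length; filter; cartesianProductWith)
import Data.List.Properties as Listₚ
open import Data.List.Membership.Propositional using (_∈_)
open import Data.List.Membership.Propositional.Properties using (∈-filter⁻; ∈-cartesianProductWith⁻)
open import Data.List.Relation.Binary.Subset.Propositional using (_⊆_)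
open import Data.List.Relation.Binary.Subset.Propositional.Properties using (filter-⊆)
open import Data.List.Relation.Unary.All using ([])
open import Data.List.Relation.Unary.AllPairs using ([]; _∷_)
open import Data.List.Relation.Unary.Any using (here)
open import Data.List.Relation.Unary.Unique.Propositional using (Unique)
import Data.List.Relation.Unary.Unique.Propositional.Properties as Unique
open import Data.Nat
open import Data.Nat.Divisibility using (_∣_; m∣m*n)
open import Data.Nat.Properties
open import Data.Nat.Tactic.RingSolver using (solve-∀)
open import Data.Product using (∃; _×_; _,_; proj₂; swap)
import Data.Rational as ℚ
import Data.Rational.Properties as ℚₚ
open import Data.Rational.Unnormalised as ℚᵘ using (ℚᵘ; mkℚᵘ; *≤*)
import Data.Rational.Unnormalised.Properties as ℚᵘₚ
open import Data.Sum using (inj₁; inj₂)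
open import Data.Vec using ([]; _∷_; _++_)
open import Data.Vec.Properties using (++-injective; zipWith-++)
open import Function using (_⇔_; mk⇔; Equivalence)
open import Relation.Binary.PropositionalEquality
  using (_≡_; refl; sym; trans; subst; subst₂; cong; cong₂; module ≡-Reasoning)
open import Relation.Nullary using (yes; no)

private
  variable
    k l m n : ℕ
    𝒜 ℬ 𝒜′ ℬ′ : Family n

^-distribʳ-* : ∀ m n o → (m * n) ^ o ≡ m ^ o * n ^ o
^-distribʳ-* m n zero    = refl
^-distribʳ-* m n (suc o) = begin
  m * n * (m * n) ^ o     ≡⟨ cong (m * n *_) (^-distribʳ-* m n o) ⟩
  m * n * (m ^ o * n ^ o) ≡⟨ interchange m n (m ^ o) (n ^ o) ⟩
  m * m ^ o * (n * n ^ o) ∎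
  where
  open ≡-Reasoning
  interchange : ∀ a b c d → a * b * (c * d) ≡ a * c * (b * d)
  interchange = solve-∀

^-*-assoc′ : ∀ m n o → (m ^ n) ^ o ≡ m ^ (o * n)
^-*-assoc′ m n o = trans (^-*-assoc m n o) (cong (m ^_) (*-comm n o))

^-cancelˡ-≤ : ∀ n .{{_ : NonZero n}} {m o} → m ^ n ≤ o ^ n → m ≤ o
^-cancelˡ-≤ n mⁿ≤oⁿ = ≮⇒≥ λ o<m → <⇒≱ (^-monoˡ-< n o<m) mⁿ≤oⁿ

*-^-cancelˡ-≤ : ∀ k .{{_ : NonZero k}} n {m a b} → m ^ k * b ^ (k * n) ≤ a ^ (k * n) → m * b ^ n ≤ a ^ n
*-^-cancelˡ-≤ k n {m} {a} {b} mᵏbᵏⁿ≤aᵏⁿ = ^-cancelˡ-≤ k (begin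
  (m * b ^ n) ^ k      ≡⟨ ^-distribʳ-* m (b ^ n) k ⟩
  m ^ k * (b ^ n) ^ k  ≡⟨ cong (m ^ k *_) (^-*-assoc′ b n k) ⟩
  m ^ k * b ^ (k * n)  ≤⟨ mᵏbᵏⁿ≤aᵏⁿ ⟩
  a ^ (k * n)          ≡⟨ ^-*-assoc′ a n k ⟨
  (a ^ n) ^ k          ∎)
  where open ≤-Reasoning

suc[m*n]≤suc[m]*suc[n] : ∀ m n → suc (m * n) ≤ suc m * suc n
suc[m*n]≤suc[m]*suc[n] m n = ≤-trans (m≤m+n (suc (m * n)) (m + n)) (≤-reflexive (expand m n))
  where
  expand : ∀ m n → suc (m * n) + (m + n) ≡ suc m * suc n
  expand = solve-∀

n<2^n : ∀ n → n < 2 ^ n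
n<2^n zero    = s≤s z≤n
n<2^n (suc n) = begin-strict
  suc n         <⟨ +-mono-≤ (m^n>0 2 n) (n<2^n n) ⟩
  2 ^ n + 2 ^ n ≡⟨ cong (2 ^ n +_) (+-identityʳ (2 ^ n)) ⟨
  2 ^ suc n     ∎
  where open ≤-Reasoning

m^n*[m+n]≤m*[1+m]^n : ∀ m n → m ^ n * (m + n) ≤ m * suc m ^ n
m^n*[m+n]≤m*[1+m]^n m zero    = ≤-reflexive (solve m)
  where
  solve : ∀ m → 1 * (m + 0) ≡ m * 1
  solve = solve-∀
m^n*[m+n]≤m*[1+m]^n m (suc n) = begin
  m * m ^ n * (m + suc n)                 ≤⟨ m≤m+n _ (n * m ^ n) ⟩
  m * m ^ n * (m + suc n) + n * m ^ n     ≡⟨ regroup m n (m ^ n) ⟩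
  suc m * (m ^ n * (m + n))               ≤⟨ *-monoʳ-≤ (suc m) (m^n*[m+n]≤m*[1+m]^n m n) ⟩
  suc m * (m * suc m ^ n)                 ≡⟨ x∙yz≈y∙xz (suc m) m (suc m ^ n) ⟩
  m * (suc m * suc m ^ n)                 ∎
  where
  open ≤-Reasoning
  regroup : ∀ m n p → m * p * (m + suc n) + n * p ≡ suc m * (p * (m + n))
  regroup = solve-∀
  x∙yz≈y∙xz : ∀ a b c → a * (b * c) ≡ b * (a * c)
  x∙yz≈y∙xz = solve-∀

2*m^m≤[1+m]^m : ∀ m .{{_ : NonZero m}} → 2 * m ^ m ≤ suc m ^ m
2*m^m≤[1+m]^m m = *-cancelˡ-≤ m (begin
  m * (2 * m ^ m)   ≡⟨ rearrange m (m ^ m) ⟩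
  m ^ m * (m + m)   ≤⟨ m^n*[m+n]≤m*[1+m]^n m m ⟩
  m * suc m ^ m     ∎)
  where
  open ≤-Reasoning
  rearrange : ∀ m p → m * (2 * p) ≡ p * (m + m)
  rearrange = solve-∀

poly<2^ : ∀ d D → ∃ λ j → D * suc j ^ d < 2 ^ j
poly<2^ zero    D = D , subst (_< 2 ^ D) (sym (*-identityʳ D)) (n<2^n D)
poly<2^ (suc d) D with j , hⱼ ← poly<2^ d (D * 2 ^ suc d) = j + j , (begin-strict
  D * suc (j + j) ^ suc d                ≤⟨ *-monoʳ-≤ D (^-monoˡ-≤ (suc d) (suc[j+j]≤2*suc[j])) ⟩
  D * (2 * suc j) ^ suc d                ≡⟨ cong (D *_) (^-distribʳ-* 2 (suc j) (suc d)) ⟩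
  D * (2 ^ suc d * (suc j * suc j ^ d))  ≡⟨ regroup D (2 ^ suc d) (suc j) (suc j ^ d) ⟩
  D * 2 ^ suc d * suc j ^ d * suc j      <⟨ *-monoˡ-< (suc j) hⱼ ⟩
  2 ^ j * suc j                          ≤⟨ *-monoʳ-≤ (2 ^ j) (n<2^n j) ⟩
  2 ^ j * 2 ^ j                          ≡⟨ ^-distribˡ-+-* 2 j j ⟨
  2 ^ (j + j)                            ∎)
  where
  open ≤-Reasoning
  double : ∀ j → 2 * suc j ≡ suc (suc (j + j))
  double = solve-∀
  suc[j+j]≤2*suc[j] : suc (j + j) ≤ 2 * suc j
  suc[j+j]≤2*suc[j] = ≤-trans (n≤1+n _) (≤-reflexive (sym (double j)))
  regroup : ∀ D P s S → D * (P * (s * S)) ≡ D * P * S * s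
  regroup = solve-∀

-- With s = y * j, Bernoulli's inequality 2 yʸ ≤ (1 + y)ʸ reduces this to base 2.
poly<exp : ∀ d C {y x} → y < x → ∃ λ s → C * suc s ^ d * y ^ s < x ^ s
poly<exp d C {zero}  {x} 0<x = 1 , (begin-strict
  C * 2 ^ d * 0 ≡⟨ *-zeroʳ (C * 2 ^ d) ⟩
  0             <⟨ 0<x ⟩
  x             ≡⟨ *-identityʳ x ⟨
  x ^ 1         ∎)
  where open ≤-Reasoning
poly<exp d C {y@(suc _)} {x} y<x with j , hⱼ ← poly<2^ d (C * suc y ^ d) = y * j , (begin-strict
  C * suc (y * j) ^ d * y ^ (y * j)
    ≤⟨ *-monoˡ-≤ (y ^ (y * j)) (*-monoʳ-≤ C (^-monoˡ-≤ d (suc[m*n]≤suc[m]*suc[n] y j))) ⟩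
  C * (suc y * suc j) ^ d * y ^ (y * j)
    ≡⟨ cong₂ (λ p r → C * p * r) (^-distribʳ-* (suc y) (suc j) d) (sym (^-*-assoc y y j)) ⟩
  C * (suc y ^ d * suc j ^ d) * (y ^ y) ^ j
    ≡⟨ cong (_* (y ^ y) ^ j) (*-assoc C (suc y ^ d) (suc j ^ d)) ⟨
  C * suc y ^ d * suc j ^ d * (y ^ y) ^ j
    <⟨ *-monoˡ-< ((y ^ y) ^ j) {{m^n≢0 (y ^ y) j {{m^n≢0 y y}}}} hⱼ ⟩
  2 ^ j * (y ^ y) ^ j
    ≡⟨ ^-distribʳ-* 2 (y ^ y) j ⟨
  (2 * y ^ y) ^ j
    ≤⟨ ^-monoˡ-≤ j (≤-trans (2*m^m≤[1+m]^m y) (^-monoˡ-≤ y y<x)) ⟩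
  (x ^ y) ^ j
    ≡⟨ ^-*-assoc x y j ⟩
  x ^ (y * j)
    ∎)
  where open ≤-Reasoning

polynomial-loss : ∀ {x A B} c d →
                  (∀ t → ∃ λ W → x ^ t ≤ suc (t * c) ^ d * W × W * B ^ t ≤ A ^ t) →
                  x * B ≤ A
polynomial-loss {x} {A} {B} c d bound = ≮⇒≥ λ A<xB →
  let s , hₛ = poly<exp d (suc c ^ d) A<xB in <⇒≱ hₛ (power-bound s)
  where
  power-bound : ∀ t → (x * B) ^ t ≤ suc c ^ d * suc t ^ d * A ^ t
  power-bound t with W , xᵗ≤ , WBᵗ≤ ← bound t = begin
    (x * B) ^ t                      ≡⟨ ^-distribʳ-* x B t ⟩
    x ^ t * B ^ t                    ≤⟨ *-monoˡ-≤ (B ^ t) xᵗ≤ ⟩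
    suc (t * c) ^ d * W * B ^ t      ≡⟨ *-assoc (suc (t * c) ^ d) W (B ^ t) ⟩
    suc (t * c) ^ d * (W * B ^ t)    ≤⟨ *-monoʳ-≤ (suc (t * c) ^ d) WBᵗ≤ ⟩
    suc (t * c) ^ d * A ^ t          ≤⟨ *-monoˡ-≤ (A ^ t) (^-monoˡ-≤ d (suc[m*n]≤suc[m]*suc[n] t c)) ⟩
    (suc t * suc c) ^ d * A ^ t      ≡⟨ cong (λ r → r ^ d * A ^ t) (*-comm (suc t) (suc c)) ⟩
    (suc c * suc t) ^ d * A ^ t      ≡⟨ cong (_* A ^ t) (^-distribʳ-* (suc c) (suc t) d) ⟩
    suc c ^ d * suc t ^ d * A ^ t    ∎
    where open ≤-Reasoning

-- Powers are taken in ℚᵘ, where products are not normalised, so the numerator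
-- and denominator of qᵐ are those of q raised to the m-th power.
infixr 8 _^ᵘ_

_^ᵘ_ : ℚᵘ → ℕ → ℚᵘ
p ^ᵘ zero  = ℚᵘ.1ℚᵘ
p ^ᵘ suc m = p ℚᵘ.* p ^ᵘ m

toℚᵘ-homo-^ : ∀ p m → ℚ.toℚᵘ (p ^ℚ m) ℚᵘ.≃ ℚ.toℚᵘ p ^ᵘ m
toℚᵘ-homo-^ p zero    = ℚᵘₚ.≃-refl
toℚᵘ-homo-^ p (suc m) = ℚᵘₚ.≃-trans (ℚₚ.toℚᵘ-homo-* p (p ^ℚ m))
                                    (ℚᵘₚ.*-congˡ {ℚ.toℚᵘ p} (toℚᵘ-homo-^ p m))

↥-* : ∀ p q → ℚᵘ.↥ (p ℚᵘ.* q) ≡ ℚᵘ.↥ p ℤ.* ℚᵘ.↥ q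
↥-* (mkℚᵘ _ _) (mkℚᵘ _ _) = refl

↧ₙ-* : ∀ p q → ℚᵘ.↧ₙ (p ℚᵘ.* q) ≡ ℚᵘ.↧ₙ p * ℚᵘ.↧ₙ q
↧ₙ-* (mkℚᵘ _ _) (mkℚᵘ _ _) = refl

↥-^ᵘ : ∀ {p a} → ℚᵘ.↥ p ≡ ℤ.+ a → ∀ m → ℚᵘ.↥ (p ^ᵘ m) ≡ ℤ.+ (a ^ m)
↥-^ᵘ         _    zero    = refl
↥-^ᵘ {p} {a} ↥p≡a (suc m) = begin
  ℚᵘ.↥ (p ℚᵘ.* p ^ᵘ m)          ≡⟨ ↥-* p (p ^ᵘ m) ⟩
  ℚᵘ.↥ p ℤ.* ℚᵘ.↥ (p ^ᵘ m)      ≡⟨ cong₂ ℤ._*_ ↥p≡a (↥-^ᵘ ↥p≡a m) ⟩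
  ℤ.+ a ℤ.* ℤ.+ (a ^ m)         ≡⟨ ℤₚ.pos-* a (a ^ m) ⟨
  ℤ.+ (a ^ suc m)               ∎
  where open ≡-Reasoning

↧ₙ-^ᵘ : ∀ p m → ℚᵘ.↧ₙ (p ^ᵘ m) ≡ ℚᵘ.↧ₙ p ^ m
↧ₙ-^ᵘ p zero    = refl
↧ₙ-^ᵘ p (suc m) = trans (↧ₙ-* p (p ^ᵘ m)) (cong (ℚᵘ.↧ₙ p *_) (↧ₙ-^ᵘ p m))

ℕ≤ᵘ⇔ : ∀ Y {r a} → ℚᵘ.↥ r ≡ ℤ.+ a → (mkℚᵘ (ℤ.+ Y) 0 ℚᵘ.≤ r) ⇔ (Y * ℚᵘ.↧ₙ r ≤ a)
ℕ≤ᵘ⇔ Y {r} {a} ↥r≡a = mk⇔ (λ { (*≤* le) → ℤₚ.drop‿+≤+ (subst₂ ℤ._≤_ lhs rhs le) })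
                          (λ le → *≤* (subst₂ ℤ._≤_ (sym lhs) (sym rhs) (ℤ.+≤+ le)))
  where
  lhs : ℤ.+ Y ℤ.* ℚᵘ.↧ r ≡ ℤ.+ (Y * ℚᵘ.↧ₙ r)
  lhs = sym (ℤₚ.pos-* Y (ℚᵘ.↧ₙ r))
  rhs : ℚᵘ.↥ r ℤ.* ℤ.+ 1 ≡ ℤ.+ a
  rhs = trans (ℤₚ.*-identityʳ (ℚᵘ.↥ r)) ↥r≡a

ℕ≤^⇔ : ∀ {q} → ℚ.0ℚ ℚ.≤ q → ∀ Y m →
       (ℕ→ℚ Y ℚ.≤ q ^ℚ m) ⇔ (Y * ℚ.↧ₙ q ^ m ≤ ℤ.∣ ℚ.↥ q ∣ ^ m)
ℕ≤^⇔ {ℚ.mkℚ -[1+ _ ] _ _} (ℚ.*≤* ())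
ℕ≤^⇔ {q@(ℚ.mkℚ (ℤ.+ a) d _)} _ Y m = mk⇔
  (λ le → subst (λ b → Y * b ≤ a ^ m) (↧ₙ-^ᵘ (ℚ.toℚᵘ q) m)
            (Equivalence.to ℕ≤qᵐ⇔ (ℚᵘₚ.≤-respˡ-≃ (ℚₚ.toℚᵘ-fromℚᵘ Yᵘ)
              (ℚᵘₚ.≤-respʳ-≃ (toℚᵘ-homo-^ q m) (ℚₚ.toℚᵘ-mono-≤ le)))))
  (λ le → ℚₚ.toℚᵘ-cancel-≤ (ℚᵘₚ.≤-respˡ-≃ (ℚᵘₚ.≃-sym (ℚₚ.toℚᵘ-fromℚᵘ Yᵘ))
            (ℚᵘₚ.≤-respʳ-≃ (ℚᵘₚ.≃-sym (toℚᵘ-homo-^ q m))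
              (Equivalence.from ℕ≤qᵐ⇔ (subst (λ b → Y * b ≤ a ^ m) (sym (↧ₙ-^ᵘ (ℚ.toℚᵘ q) m)) le)))))
  where
  Yᵘ : ℚᵘ
  Yᵘ = mkℚᵘ (ℤ.+ Y) 0
  ℕ≤qᵐ⇔ : (Yᵘ ℚᵘ.≤ ℚ.toℚᵘ q ^ᵘ m) ⇔ (Y * ℚᵘ.↧ₙ (ℚ.toℚᵘ q ^ᵘ m) ≤ a ^ m)
  ℕ≤qᵐ⇔ = ℕ≤ᵘ⇔ Y (↥-^ᵘ refl m)

sum≤ : ℕ → (ℕ → ℕ) → ℕ
sum≤ zero    g = g 0
sum≤ (suc N) g = g (suc N) + sum≤ N g

sum≤-mono : ∀ N {g h} → (∀ a → g a ≤ h a) → sum≤ N g ≤ sum≤ N h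
sum≤-mono zero    g≤h = g≤h 0
sum≤-mono (suc N) g≤h = +-mono-≤ (g≤h (suc N)) (sum≤-mono N g≤h)

sum≤-mono-< : ∀ N {g h i} → (∀ a → g a ≤ h a) → i ≤ N → g i < h i → sum≤ N g < sum≤ N h
sum≤-mono-< zero    g≤h z≤n gᵢ<hᵢ = gᵢ<hᵢ
sum≤-mono-< (suc N) {i = i} g≤h i≤N gᵢ<hᵢ with i ≟ suc N
... | yes refl = +-mono-<-≤ gᵢ<hᵢ (sum≤-mono N g≤h)
... | no  i≢N  = +-mono-≤-< (g≤h (suc N)) (sum≤-mono-< N g≤h (≤-pred (≤∧≢⇒< i≤N i≢N)) gᵢ<hᵢ)

sum≤-argmax : ∀ N g → ∃ λ a → a ≤ N × sum≤ N g ≤ suc N * g a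
sum≤-argmax zero    g = 0 , z≤n , ≤-reflexive (sym (+-identityʳ (g 0)))
sum≤-argmax (suc N) g with a , a≤N , total≤ ← sum≤-argmax N g | g a ≤? g (suc N)
... | yes gₐ≤gₙ = suc N , ≤-refl , +-monoʳ-≤ (g (suc N)) (≤-trans total≤ (*-monoʳ-≤ (suc N) gₐ≤gₙ))
... | no  gₐ≰gₙ = a , m≤n⇒m≤1+n a≤N , +-mono-≤ (≰⇒≥ gₐ≰gₙ) total≤

module _ {A : Set} (f : A → ℕ) where

  fibre : ℕ → List A → List A
  fibre a = filter (λ x → f x ≟ a)

  fibre-length-mono-∷ : ∀ x xs a → length (fibre a xs) ≤ length (fibre a (x ∷ xs))
  fibre-length-mono-∷ x xs a with f x ≟ a
  ... | yes fx≡a rewrite Listₚ.filter-accept (λ y → f y ≟ a) {x} {xs} fx≡a = n≤1+n _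
  ... | no  fx≢a rewrite Listₚ.filter-reject (λ y → f y ≟ a) {x} {xs} fx≢a = ≤-refl

  fibre-length-<-∷ : ∀ x xs → length (fibre (f x) xs) < length (fibre (f x) (x ∷ xs))
  fibre-length-<-∷ x xs rewrite Listₚ.filter-accept (λ y → f y ≟ f x) {x} {xs} refl = ≤-refl

  length≤sum-fibres : (∀ x → f x ≤ n) → ∀ xs → length xs ≤ sum≤ n (λ a → length (fibre a xs))
  length≤sum-fibres         f≤n []       = z≤n
  length≤sum-fibres {n = n} f≤n (x ∷ xs) =
    ≤-trans (s≤s (length≤sum-fibres f≤n xs))
            (sum≤-mono-< n (fibre-length-mono-∷ x xs) (f≤n x) (fibre-length-<-∷ x xs))

  pigeonhole-fibre : (∀ x → f x ≤ n) → ∀ xs → ∃ λ a → a ≤ n × length xs ≤ suc n * length (fibre a xs)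
  pigeonhole-fibre {n = n} f≤n xs with a , a≤n , total≤ ← sum≤-argmax n (λ a → length (fibre a xs)) =
    a , a≤n , ≤-trans (length≤sum-fibres f≤n xs) total≤

LeftCancellative : Family n → Family n → Set
LeftCancellative 𝒜 ℬ = ∀ {A A′ B} → A ∈ 𝒜 → A′ ∈ 𝒜 → B ∈ ℬ → A ∪ B ≡ A′ ∪ B → A ≡ A′

Cancellative⇔ : Cancellative 𝒜 ℬ ⇔ (LeftCancellative 𝒜 ℬ × LeftCancellative ℬ 𝒜)
Cancellative⇔ = mk⇔ (λ (l , r) → l , λ B∈ B′∈ A∈ eq → r A∈ B∈ B′∈ (∪-swap eq))
                    (λ (l , l′) → l , λ A∈ B∈ B′∈ eq → l′ B∈ B′∈ A∈ (∪-swap eq))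
  where
  ∪-swap : ∀ {n} {X X′ Y Y′ : Subset n} → X ∪ Y ≡ X′ ∪ Y′ → Y ∪ X ≡ Y′ ∪ X′
  ∪-swap {X = X} {X′} {Y} {Y′} eq = trans (∪-comm Y X) (trans eq (∪-comm X′ Y′))

CancellativePair : Family n → Family n → Set
CancellativePair 𝒜 ℬ = Unique 𝒜 × Unique ℬ × Cancellative 𝒜 ℬ

CancellativePair-swap : CancellativePair 𝒜 ℬ → CancellativePair ℬ 𝒜
CancellativePair-swap (u𝒜 , uℬ , c) =
  uℬ , u𝒜 , Equivalence.from Cancellative⇔ (swap (Equivalence.to Cancellative⇔ c))

CancellativePair-⊆ : 𝒜′ ⊆ 𝒜 → ℬ′ ⊆ ℬ → Unique 𝒜′ → Unique ℬ′ →
                     CancellativePair 𝒜 ℬ → CancellativePair 𝒜′ ℬ′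
CancellativePair-⊆ 𝒜′⊆𝒜 ℬ′⊆ℬ u𝒜′ uℬ′ (_ , _ , l , r) =
  u𝒜′ , uℬ′ ,
  (λ A∈ A′∈ B∈ → l (𝒜′⊆𝒜 A∈) (𝒜′⊆𝒜 A′∈) (ℬ′⊆ℬ B∈)) ,
  (λ A∈ B∈ B′∈ → r (𝒜′⊆𝒜 A∈) (ℬ′⊆ℬ B∈) (ℬ′⊆ℬ B′∈))

CancellativePair-[_] : (p : Subset n) → CancellativePair [ p ] [ p ]
CancellativePair-[ p ] = [] ∷ [] , [] ∷ [] ,
  (λ { (here refl) (here refl) _ _ → refl }) ,
  (λ { _ (here refl) (here refl) _ → refl })

_⊗_ : Family m → Family n → Family (m + n)
_⊗_ = cartesianProductWith _++_

∈-⊗⁻ : ∀ (𝒜 : Family m) (ℬ : Family n) {C} → C ∈ 𝒜 ⊗ ℬ → ∃ λ A → ∃ λ B → A ∈ 𝒜 × B ∈ ℬ × C ≡ A ++ B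
∈-⊗⁻ = ∈-cartesianProductWith⁻ _++_

length-⊗ : ∀ (𝒜 : Family m) (ℬ : Family n) → length (𝒜 ⊗ ℬ) ≡ length 𝒜 * length ℬ
length-⊗ []       ℬ = refl
length-⊗ (A ∷ 𝒜) ℬ =
  trans (Listₚ.length-++ (List.map (A ++_) ℬ)) (cong₂ _+_ (Listₚ.length-map (A ++_) ℬ) (length-⊗ 𝒜 ℬ))

∣++∣ : ∀ (A : Subset m) (B : Subset n) → ∣ A ++ B ∣ ≡ ∣ A ∣ + ∣ B ∣
∣++∣ []           B = refl
∣++∣ (true  ∷ A) B = cong suc (∣++∣ A B)
∣++∣ (false ∷ A) B = ∣++∣ A B

Unique-⊗ : {𝒜 : Family m} {ℬ : Family n} → Unique 𝒜 → Unique ℬ → Unique (𝒜 ⊗ ℬ)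
Unique-⊗ = Unique.cartesianProductWith⁺ _++_ (λ {A} {A′} → ++-injective A A′)

LeftCancellative-⊗ : {𝒜₁ ℬ₁ : Family m} {𝒜₂ ℬ₂ : Family n} →
                     LeftCancellative 𝒜₁ ℬ₁ → LeftCancellative 𝒜₂ ℬ₂ →
                     LeftCancellative (𝒜₁ ⊗ 𝒜₂) (ℬ₁ ⊗ ℬ₂)
LeftCancellative-⊗ {𝒜₁ = 𝒜₁} {ℬ₁} {𝒜₂} {ℬ₂} l₁ l₂ C∈ C′∈ D∈ eq
  with A₁ , A₂ , A₁∈ , A₂∈ , refl ← ∈-⊗⁻ 𝒜₁ 𝒜₂ C∈
     | A₁′ , A₂′ , A₁′∈ , A₂′∈ , refl ← ∈-⊗⁻ 𝒜₁ 𝒜₂ C′∈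
     | B₁ , B₂ , B₁∈ , B₂∈ , refl ← ∈-⊗⁻ ℬ₁ ℬ₂ D∈
  with eq₁ , eq₂ ← ++-injective (A₁ ∪ B₁) (A₁′ ∪ B₁)
         (trans (sym (zipWith-++ _ A₁ A₂ B₁ B₂)) (trans eq (zipWith-++ _ A₁′ A₂′ B₁ B₂)))
  = cong₂ _++_ (l₁ A₁∈ A₁′∈ B₁∈ eq₁) (l₂ A₂∈ A₂′∈ B₂∈ eq₂)

CancellativePair-⊗ : {𝒜₁ ℬ₁ : Family m} {𝒜₂ ℬ₂ : Family n} →
                     CancellativePair 𝒜₁ ℬ₁ → CancellativePair 𝒜₂ ℬ₂ →
                     CancellativePair (𝒜₁ ⊗ 𝒜₂) (ℬ₁ ⊗ ℬ₂)
CancellativePair-⊗ (u𝒜₁ , uℬ₁ , c₁) (u𝒜₂ , uℬ₂ , c₂)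
  with l₁ , l₁′ ← Equivalence.to Cancellative⇔ c₁
     | l₂ , l₂′ ← Equivalence.to Cancellative⇔ c₂
  = Unique-⊗ u𝒜₁ u𝒜₂ , Unique-⊗ uℬ₁ uℬ₂ ,
    Equivalence.from Cancellative⇔ (LeftCancellative-⊗ l₁ l₂ , LeftCancellative-⊗ l₁′ l₂′)

Uniform-⊗ : {𝒜 : Family m} {ℬ : Family n} → Uniform k 𝒜 → Uniform l ℬ → Uniform (k + l) (𝒜 ⊗ ℬ)
Uniform-⊗ {𝒜 = 𝒜} {ℬ} u𝒜 uℬ C∈ with A , B , A∈ , B∈ , refl ← ∈-⊗⁻ 𝒜 ℬ C∈ =
  trans (∣++∣ A B) (cong₂ _+_ (u𝒜 A∈) (uℬ B∈))

_^⊗_ : Family n → (t : ℕ) → Family (t * n)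
𝒜 ^⊗ zero  = [ [] ]
𝒜 ^⊗ suc t = 𝒜 ⊗ (𝒜 ^⊗ t)

length-^⊗ : ∀ (𝒜 : Family n) t → length (𝒜 ^⊗ t) ≡ length 𝒜 ^ t
length-^⊗ 𝒜 zero    = refl
length-^⊗ 𝒜 (suc t) = trans (length-⊗ 𝒜 (𝒜 ^⊗ t)) (cong (length 𝒜 *_) (length-^⊗ 𝒜 t))

CancellativePair-^⊗ : ∀ t → CancellativePair 𝒜 ℬ → CancellativePair (𝒜 ^⊗ t) (ℬ ^⊗ t)
CancellativePair-^⊗ zero    _ = CancellativePair-[ [] ]
CancellativePair-^⊗ (suc t) p = CancellativePair-⊗ p (CancellativePair-^⊗ t p)

Uniform-^⊗ : ∀ t → Uniform k 𝒜 → Uniform (t * k) (𝒜 ^⊗ t)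
Uniform-^⊗ zero    _   (here refl) = refl
Uniform-^⊗ (suc t) u𝒜 C∈          = Uniform-⊗ u𝒜 (Uniform-^⊗ t u𝒜) C∈

layer : ℕ → Family n → Family n
layer = fibre ∣_∣

Uniform-layer : ∀ a (𝒜 : Family n) → Uniform a (layer a 𝒜)
Uniform-layer a 𝒜 A∈ = proj₂ (∈-filter⁻ (λ A → ∣ A ∣ ≟ a) {xs = 𝒜} A∈)

CancellativePair-layer : ∀ a b → CancellativePair 𝒜 ℬ → CancellativePair (layer a 𝒜) (layer b ℬ)
CancellativePair-layer a b p@(u𝒜 , uℬ , _) =
  CancellativePair-⊆ (filter-⊆ _ _) (filter-⊆ _ _) (Unique.filter⁺ _ u𝒜) (Unique.filter⁺ _ uℬ) p

pigeonhole-layer : ∀ (𝒜 : Family n) → ∃ λ a → a ≤ n × length 𝒜 ≤ suc n * length (layer a 𝒜)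
pigeonhole-layer = pigeonhole-fibre ∣_∣ ∣p∣≤n

upper-nonNeg : ∀ (β : PosReal) {q} → PosReal.U β q → ℚ.0ℚ ℚ.≤ q
upper-nonNeg β {q} q∈U with p , 0<p , p∉U ← PosReal.positive β | ℚₚ.≤-total q p
... | inj₁ q≤p = ⊥-elim (p∉U (PosReal.upward β q∈U q≤p))
... | inj₂ p≤q = ℚₚ.<⇒≤ (ℚₚ.<-≤-trans 0<p p≤q)

≤β^⇔ : ∀ β Y m → (Y ≤β^ β) m ⇔ (∀ {q} → PosReal.U β q → Y * ℚ.↧ₙ q ^ m ≤ ℤ.∣ ℚ.↥ q ∣ ^ m)
≤β^⇔ β Y m = mk⇔ (λ Y≤βᵐ {q} q∈U → Equivalence.to (ℕ≤^⇔ (upper-nonNeg β q∈U) Y m) (Y≤βᵐ q q∈U))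
                 (λ Y≤qᵐ _ q∈U → Equivalence.from (ℕ≤^⇔ (upper-nonNeg β q∈U) Y m) (Y≤qᵐ q∈U))

≤β^-root : ∀ β Y k .{{_ : NonZero k}} n → ((Y ^ k) ≤β^ β) (k * n) → (Y ≤β^ β) n
≤β^-root β Y k n Yᵏ≤βᵏⁿ = Equivalence.from (≤β^⇔ β Y n) λ q∈U →
  *-^-cancelˡ-≤ k n (Equivalence.to (≤β^⇔ β (Y ^ k) (k * n)) Yᵏ≤βᵏⁿ q∈U)

≤β^-polynomial-loss : ∀ β X n d → (∀ t → ∃ λ W → X ^ t ≤ suc (t * n) ^ d * W × (W ≤β^ β) (t * n)) →
                      (X ≤β^ β) n
≤β^-polynomial-loss β X n d bound = Equivalence.from (≤β^⇔ β X n) λ {q} q∈U →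
  polynomial-loss n d λ t →
    let W , Xᵗ≤ , W≤βᵗⁿ = bound t in
    W , Xᵗ≤ , subst₂ (λ B A → W * B ≤ A) (sym (^-*-assoc′ (ℚ.↧ₙ q) n t)) (sym (^-*-assoc′ ℤ.∣ ℚ.↥ q ∣ n t))
                     (Equivalence.to (≤β^⇔ β W (t * n)) W≤βᵗⁿ q∈U)

UniformBounds : PosReal → Set
UniformBounds β = ∀ k n → k ≤ n → ck≤β^ β k n

uniformBounds-from-divisible : ∀ M .{{_ : NonZero M}} β →
                               (∀ k n → M ∣ k → k ≤ n → ck≤β^ β k n) → UniformBounds β
uniformBounds-from-divisible M β H k n k≤n 𝒜 ℬ u𝒜 uℬ c 𝒜ₖ ℬₖ =
  let u𝒜ᴹ , uℬᴹ , cᴹ = CancellativePair-^⊗ M (u𝒜 , uℬ , c) in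
  ≤β^-root β (length 𝒜 * length ℬ) M n (subst (λ Y → (Y ≤β^ β) (M * n)) lengths
    (H (M * k) (M * n) (m∣m*n k) (*-monoʳ-≤ M k≤n) (𝒜 ^⊗ M) (ℬ ^⊗ M) u𝒜ᴹ uℬᴹ cᴹ
       (Uniform-^⊗ M 𝒜ₖ) (Uniform-^⊗ M ℬₖ)))
  where
  lengths : length (𝒜 ^⊗ M) * length (ℬ ^⊗ M) ≡ (length 𝒜 * length ℬ) ^ M
  lengths = trans (cong₂ _*_ (length-^⊗ 𝒜 M) (length-^⊗ ℬ M)) (sym (^-distribʳ-* (length 𝒜) (length ℬ) M))

biuniform-bound : ∀ β → UniformBounds β → ∀ {n a b} {𝒜 ℬ : Family n} → a ≤ n → b ≤ n →
                  CancellativePair 𝒜 ℬ → Uniform a 𝒜 → Uniform b ℬ → ((length 𝒜 * length ℬ) ≤β^ β) n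
biuniform-bound β H {n} {a} {b} {𝒜} {ℬ} a≤n b≤n p 𝒜ₐ ℬᵦ =
  let u , u′ , c = CancellativePair-⊗ p (CancellativePair-swap p) in
  ≤β^-root β (length 𝒜 * length ℬ) 2 n (subst₂ (λ Y N → (Y ≤β^ β) N) lengths (cong (n +_) (sym (+-identityʳ n)))
    (H (a + b) (n + n) (+-mono-≤ a≤n b≤n) (𝒜 ⊗ ℬ) (ℬ ⊗ 𝒜) u u′ c
       (Uniform-⊗ 𝒜ₐ ℬᵦ) (subst (λ k → Uniform k (ℬ ⊗ 𝒜)) (+-comm b a) (Uniform-⊗ ℬᵦ 𝒜ₐ))))
  where
  square : ∀ x y → x * y * (y * x) ≡ x * y * (x * y * 1)
  square = solve-∀
  lengths : length (𝒜 ⊗ ℬ) * length (ℬ ⊗ 𝒜) ≡ (length 𝒜 * length ℬ) ^ 2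
  lengths = trans (cong₂ _*_ (length-⊗ 𝒜 ℬ) (length-⊗ ℬ 𝒜)) (square (length 𝒜) (length ℬ))

c≤β^-from-uniformBounds : ∀ β → UniformBounds β → ∀ n → c≤β^ β n
c≤β^-from-uniformBounds β H n 𝒜 ℬ u𝒜 uℬ c = ≤β^-polynomial-loss β (length 𝒜 * length ℬ) n 2 tensor-power-bound
  where
  tensor-power-bound : ∀ t → ∃ λ W → (length 𝒜 * length ℬ) ^ t ≤ suc (t * n) ^ 2 * W × (W ≤β^ β) (t * n)
  tensor-power-bound t with a , a≤tn , 𝒜ᵗ≤ ← pigeonhole-layer (𝒜 ^⊗ t) | b , b≤tn , ℬᵗ≤ ← pigeonhole-layer (ℬ ^⊗ t) =
    length 𝒜ₐ * length ℬᵦ , power≤ ,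
    biuniform-bound β H a≤tn b≤tn (CancellativePair-layer a b (CancellativePair-^⊗ t (u𝒜 , uℬ , c)))
                    (Uniform-layer a (𝒜 ^⊗ t)) (Uniform-layer b (ℬ ^⊗ t))
    where
    open ≤-Reasoning
    𝒜ₐ ℬᵦ : Family (t * n)
    𝒜ₐ = layer a (𝒜 ^⊗ t)
    ℬᵦ = layer b (ℬ ^⊗ t)
    S : ℕ
    S = suc (t * n)
    regroup : ∀ S x y → S * x * (S * y) ≡ S * (S * 1) * (x * y)
    regroup = solve-∀
    power≤ : (length 𝒜 * length ℬ) ^ t ≤ S ^ 2 * (length 𝒜ₐ * length ℬᵦ)
    power≤ = begin
      (length 𝒜 * length ℬ) ^ t                   ≡⟨ ^-distribʳ-* (length 𝒜) (length ℬ) t ⟩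
      length 𝒜 ^ t * length ℬ ^ t                 ≡⟨ cong₂ _*_ (length-^⊗ 𝒜 t) (length-^⊗ ℬ t) ⟨
      length (𝒜 ^⊗ t) * length (ℬ ^⊗ t)           ≤⟨ *-mono-≤ 𝒜ᵗ≤ ℬᵗ≤ ⟩
      S * length 𝒜ₐ * (S * length ℬᵦ)             ≡⟨ regroup S (length 𝒜ₐ) (length ℬᵦ) ⟩
      S ^ 2 * (length 𝒜ₐ * length ℬᵦ)             ∎

lemma2 : (M : ℕ) → 0 < M → (β : PosReal) →
         (∀ k n → M ∣ k → k ≤ n → ck≤β^ β k n) →
         ∀ n → 0 < n → c≤β^ β n
lemma2 M 0<M β H n _ = c≤β^-from-uniformBounds β (uniformBounds-from-divisible M {{>-nonZero 0<M}} β H) n
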